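{- Let $C=(C_0,C_1,\ldots,C_{k-1})$ be an equitable partition of the halved $n$-cube $\frac12 H(n)$ with quotient matrix $S$, and let $t\ge 1$. Write each binary word of length $tn$ as $(\bar x_1,\ldots,\bar x_t)$ with $\bar x_i\in\{0,1\}^n$, and define the partition $C^{(t)}$ of the vertex set of $\frac12 H(tn)$ by $C^{(t)}(\bar x_1,\ldots,\bar x_t):=C(\bar x_1+\cdots+\bar x_t)$ (sum over GF$(2)$). Then $C^{(t)}$ is an equitable partition of $\frac12 H(tn)$ with quotient matrix $t^2S+n\frac{t(t-1)}{2}\mathrm{Id}$.
   Context: The halved $m$-cube $\frac12 H(m)$ is the graph on the binary words of length $m$ with an even number of ones, two words adjacent iff they differ in exactly two positions. A $k$-partition is identified with the function assigning to each vertex $\bar v$ the index $i$ with $\bar v\in C_i$, written $C(\bar v)=i$. An equitable $k$-partition is an ordered partition $(C_0,\ldots,C_{k-1})$ of the vertex set such that the number of neighbors in $C_j$ of any vertex of $C_i$ is a constant $S_{ij}$; $S=(S_{ij})$ is the quotient matrix. Note that if $(\bar x_1,\ldots,\bar x_t)$ has even weight then so does $\bar x_1+\cdots+\bar x_t$. -}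

module Defs where

open import Data.Bool using (Bool; true; false; _xor_; _∧_; if_then_else_)
open import Data.Nat using (ℕ; zero; suc; _+_; _*_; _∸_; _%_; _/_; _≡ᵇ_)
open import Data.Fin using (Fin)
import Data.Fin as Fin
open import Data.Vec using (Vec; []; _∷_; zipWith; replicate; countᵇ; splitAt; take; drop)
open import Data.List using (List; []; _∷_; map; _++_; length; filterᵇ)
open import Data.Product using (Σ; ∃; _,_; proj₁)
open import Relation.Binary.PropositionalEquality using (_≡_)
open import Relation.Nullary.Decidable using (⌊_⌋)

weight : ∀ {m} → Vec Bool m → ℕ
weight = countᵇ (λ b → b)

evenᵇ : ∀ {m} → Vec Bool m → Bool
evenᵇ v = weight v % 2 ≡ᵇ 0

IsVertex : ∀ {m} → Vec Bool m → Set
IsVertex v = weight v % 2 ≡ 0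

_⊕_ : ∀ {m} → Vec Bool m → Vec Bool m → Vec Bool m
_⊕_ = zipWith _xor_

dist : ∀ {m} → Vec Bool m → Vec Bool m → ℕ
dist u v = weight (u ⊕ v)

allWords : ∀ m → List (Vec Bool m)
allWords zero = [] ∷ []
allWords (suc m) = map (false ∷_) (allWords m) ++ map (true ∷_) (allWords m)

vertices : ∀ m → List (Vec Bool m)
vertices m = filterᵇ evenᵇ (allWords m)

-- A k-partition of the vertex set of ½H(m) is given as a function C from words to Fin k
-- (only its values on even-weight words matter).
nbrsIn : ∀ {m k} → (Vec Bool m → Fin k) → Vec Bool m → Fin k → ℕ
nbrsIn {m} C v j =
  length (filterᵇ (λ w → (dist v w ≡ᵇ 2) ∧ ⌊ C w Fin.≟ j ⌋) (vertices m))

-- every cell C_i is nonempty (so (C_0,…,C_{k-1}) is a genuine ordered partition)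
CellsNonempty : ∀ {m k} → (Vec Bool m → Fin k) → Set
CellsNonempty {m} C = ∀ i → ∃ λ v → IsVertex v Data.Product.× C v ≡ i

IsEquitable : ∀ m k → (Vec Bool m → Fin k) → (Fin k → Fin k → ℕ) → Set
IsEquitable m k C S =
  CellsNonempty C Data.Product.×
  (∀ v → IsVertex v → ∀ j → nbrsIn C v j ≡ S (C v) j)

blocks : ∀ t n → Vec Bool (t * n) → Vec (Vec Bool n) t
blocks zero n _ = []
blocks (suc t) n xs = take n xs ∷ blocks t n (drop n xs)

sumBlocks : ∀ {t n} → Vec (Vec Bool n) t → Vec Bool n
sumBlocks [] = replicate _ false
sumBlocks (x ∷ xs) = x ⊕ sumBlocks xs

lift : ∀ t n {k} → (Vec Bool n → Fin k) → Vec Bool (t * n) → Fin k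
lift t n C x = C (sumBlocks (blocks t n x))

Id : ∀ {k} → Fin k → Fin k → ℕ
Id i j = if ⌊ i Fin.≟ j ⌋ then 1 else 0

liftedQuotient : ∀ t n {k} → (Fin k → Fin k → ℕ) → Fin k → Fin k → ℕ
liftedQuotient t n S i j = t * t * S i j + n * (t * (t ∸ 1) / 2) * Id i j

-- Since x ↦ x̄₁ + ⋯ + x̄ₜ is GF(2)-linear, the neighbours of x in the cell j of C^(t) are the
-- words x + e with e of weight 2 and C(σx + σe) = j, where σ sums the blocks. A weight-2 word e
-- of length tn either has both ones in one block (then σe has weight 2, each such word arising
-- t times), in two blocks at different positions (σe has weight 2, each arising t(t-1) times),
-- or in two blocks at the same position (σe = 0, arising n·t(t-1)/2 times). Summing over e
-- gives t² S + n·t(t-1)/2 · Id. Formally the count goes by induction on t: a weight-2 word is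
-- u ++ w with u the first block and (|u|, |w|) ∈ {(0,2), (1,1), (2,0)}, and the (1,1) term
-- reduces to counting the ways of writing a word as a sum of two words of weight 1.
module Submission where

open import Algebra.Bundles using (CommutativeRing)
open import Data.Bool using (Bool; true; false; _xor_; _∧_; if_then_else_; T)
open import Data.Bool.Properties
  using (xor-assoc; xor-identityˡ; xor-identityʳ; xor-same; xor-∧-commutativeRing; ∧-zeroʳ)
open import Data.Fin using (Fin; _≟_)
open import Data.List using (List; []; _∷_; map; length; filterᵇ)
import Data.List as List
open import Data.List.Properties using (map-++; map-∘)
open import Data.Nat.ListAction using (sum)
open import Data.Nat.ListAction.Properties using (sum-++)
open import Data.Nat using (ℕ; zero; suc; _+_; _*_; _∸_; _%_; _/_; _≡ᵇ_; _≥_)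
open import Data.Nat.DivMod using (%-distribˡ-+; [m+kn]%n≡m%n; m*n/n≡m)
open import Data.Nat.Properties
  using (+-comm; +-suc; *-assoc; *-distribʳ-+; +-identityʳ; *-zeroʳ; *-distribˡ-+; ≡ᵇ⇒≡)
open import Data.Nat.Solver using (module +-*-Solver)
open import Data.Product using (_,_)
open import Data.Vec using (Vec; []; _∷_; zipWith; replicate; take; drop; _++_)
open import Data.Vec.Properties
  using (take-zipWith; drop-zipWith; take++drop≡id; zipWith-identityˡ; zipWith-identityʳ)
open import Function using (_∘_)
open import Relation.Binary.PropositionalEquality
open import Relation.Nullary.Decidable using (⌊_⌋)
open import Defs

open import Algebra.Properties.CommutativeSemigroup
  (CommutativeRing.+-commutativeSemigroup xor-∧-commutativeRing)
  using () renaming (interchange to xor-interchange)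
open +-*-Solver
open ≡-Reasoning

𝟙 : Bool → ℕ
𝟙 b = if b then 1 else 0

𝟙[wt≡_] : ∀ {m} → ℕ → Vec Bool m → ℕ
𝟙[wt≡ k ] v = 𝟙 (weight v ≡ᵇ k)

⊕-identityˡ : ∀ {m} (u : Vec Bool m) → replicate m false ⊕ u ≡ u
⊕-identityˡ = zipWith-identityˡ xor-identityˡ

⊕-identityʳ : ∀ {m} (u : Vec Bool m) → u ⊕ replicate m false ≡ u
⊕-identityʳ = zipWith-identityʳ xor-identityʳ

⊕-cancelˡ : ∀ {m} (u v : Vec Bool m) → u ⊕ (u ⊕ v) ≡ v
⊕-cancelˡ [] [] = refl
⊕-cancelˡ (a ∷ u) (b ∷ v) =
  cong₂ _∷_ (trans (sym (xor-assoc a a b)) (cong (_xor b) (xor-same a))) (⊕-cancelˡ u v)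

⊕-interchange : ∀ {m} (a b c d : Vec Bool m) → (a ⊕ b) ⊕ (c ⊕ d) ≡ (a ⊕ c) ⊕ (b ⊕ d)
⊕-interchange [] [] [] [] = refl
⊕-interchange (a ∷ as) (b ∷ bs) (c ∷ cs) (d ∷ ds) =
  cong₂ _∷_ (xor-interchange a b c d) (⊕-interchange as bs cs ds)

take-++ : ∀ {a} {A : Set a} n {m} (u : Vec A n) (w : Vec A m) → take n (u ++ w) ≡ u
take-++ zero [] w = refl
take-++ (suc n) (x ∷ u) w = cong (x ∷_) (take-++ n u w)

drop-++ : ∀ {a} {A : Set a} n {m} (u : Vec A n) (w : Vec A m) → drop n (u ++ w) ≡ w
drop-++ zero [] w = refl
drop-++ (suc n) (x ∷ u) w = drop-++ n u w

replicate-++ : ∀ {a} {A : Set a} n m (x : A) → replicate (n + m) x ≡ replicate n x ++ replicate m x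
replicate-++ zero m x = refl
replicate-++ (suc n) m x = cong (x ∷_) (replicate-++ n m x)

weight-++ : ∀ {a b} (u : Vec Bool a) (w : Vec Bool b) → weight (u ++ w) ≡ weight u + weight w
weight-++ [] w = refl
weight-++ (false ∷ u) w = weight-++ u w
weight-++ (true ∷ u) w = cong suc (weight-++ u w)

weight-replicate-false : ∀ m → weight (replicate m false) ≡ 0
weight-replicate-false zero = refl
weight-replicate-false (suc m) = weight-replicate-false m

weight-⊕ : ∀ {m} (u v : Vec Bool m) → weight u + weight v ≡ weight (u ⊕ v) + weight (zipWith _∧_ u v) * 2
weight-⊕ [] [] = refl
weight-⊕ (false ∷ u) (false ∷ v) = weight-⊕ u v
weight-⊕ (false ∷ u) (true ∷ v) = trans (+-suc (weight u) (weight v)) (cong suc (weight-⊕ u v))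
weight-⊕ (true ∷ u) (false ∷ v) = cong suc (weight-⊕ u v)
weight-⊕ (true ∷ u) (true ∷ v) = begin
  suc (weight u + suc (weight v))  ≡⟨ cong suc (+-suc (weight u) (weight v)) ⟩
  2 + (weight u + weight v)        ≡⟨ cong (2 +_) (weight-⊕ u v) ⟩
  2 + (x + y * 2)                  ≡⟨ solve 2 (λ x y → con 2 :+ (x :+ y :* con 2) := x :+ (con 2 :+ y :* con 2)) refl x y ⟩
  x + (2 + y * 2)                  ∎
  where x = weight (u ⊕ v)
        y = weight (zipWith _∧_ u v)

+-cong-%2 : ∀ a {b c} → b % 2 ≡ c % 2 → (a + b) % 2 ≡ (a + c) % 2
+-cong-%2 a {b} {c} b≡c = begin
  (a + b) % 2              ≡⟨ %-distribˡ-+ a b 2 ⟩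
  (a % 2 + b % 2) % 2      ≡⟨ cong (λ z → (a % 2 + z) % 2) b≡c ⟩
  (a % 2 + c % 2) % 2      ≡⟨ %-distribˡ-+ a c 2 ⟨
  (a + c) % 2              ∎

weight-⊕-%2 : ∀ {m} (u v : Vec Bool m) → weight (u ⊕ v) % 2 ≡ (weight u + weight v) % 2
weight-⊕-%2 u v = sym (trans (cong (_% 2) (weight-⊕ u v))
                             ([m+kn]%n≡m%n (weight (u ⊕ v)) (weight (zipWith _∧_ u v)) 2))

isVertex-dist≡2 : ∀ {m} (v w : Vec Bool m) → IsVertex v → dist v w ≡ 2 → IsVertex w
isVertex-dist≡2 v w v-even d≡2 = begin
  weight w % 2               ≡⟨ cong (_% 2) (+-identityʳ (weight w)) ⟨
  (weight w + 0) % 2         ≡⟨ +-cong-%2 (weight w) (sym v-even) ⟩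
  (weight w + weight v) % 2  ≡⟨ cong (_% 2) (+-comm (weight w) (weight v)) ⟩
  (weight v + weight w) % 2  ≡⟨ weight-⊕-%2 v w ⟨
  dist v w % 2               ≡⟨ cong (_% 2) d≡2 ⟩
  0                          ∎

blockSum : ∀ t n → Vec Bool (t * n) → Vec Bool n
blockSum t n = sumBlocks ∘ blocks t n

blockSum-++ : ∀ t n (u : Vec Bool n) (w : Vec Bool (t * n)) →
              blockSum (suc t) n (u ++ w) ≡ u ⊕ blockSum t n w
blockSum-++ t n u w = cong₂ _⊕_ (take-++ n u w) (cong (blockSum t n) (drop-++ n u w))

blockSum-zeros : ∀ t n → blockSum t n (replicate (t * n) false) ≡ replicate n false
blockSum-zeros zero n = refl
blockSum-zeros (suc t) n = begin
  blockSum (suc t) n (replicate (n + t * n) false)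
    ≡⟨ cong (blockSum (suc t) n) (replicate-++ n (t * n) false) ⟩
  blockSum (suc t) n (replicate n false ++ replicate (t * n) false)
    ≡⟨ blockSum-++ t n _ _ ⟩
  replicate n false ⊕ blockSum t n (replicate (t * n) false)
    ≡⟨ ⊕-identityˡ _ ⟩
  blockSum t n (replicate (t * n) false)
    ≡⟨ blockSum-zeros t n ⟩
  replicate n false ∎

blockSum-⊕ : ∀ t n (x y : Vec Bool (t * n)) → blockSum t n (x ⊕ y) ≡ blockSum t n x ⊕ blockSum t n y
blockSum-⊕ zero n x y = sym (⊕-identityˡ _)
blockSum-⊕ (suc t) n x y = begin
  take n (x ⊕ y) ⊕ blockSum t n (drop n (x ⊕ y))
    ≡⟨ cong₂ _⊕_ (take-zipWith _xor_ x y) (cong (blockSum t n) (drop-zipWith _xor_ x y)) ⟩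
  (take n x ⊕ take n y) ⊕ blockSum t n (drop n x ⊕ drop n y)
    ≡⟨ cong ((take n x ⊕ take n y) ⊕_) (blockSum-⊕ t n _ _) ⟩
  (take n x ⊕ take n y) ⊕ (blockSum t n (drop n x) ⊕ blockSum t n (drop n y))
    ≡⟨ ⊕-interchange _ _ _ _ ⟩
  blockSum (suc t) n x ⊕ blockSum (suc t) n y ∎

weight-blockSum-%2 : ∀ t n (x : Vec Bool (t * n)) → weight (blockSum t n x) % 2 ≡ weight x % 2
weight-blockSum-%2 zero n [] = cong (_% 2) (weight-replicate-false n)
weight-blockSum-%2 (suc t) n x = begin
  weight (take n x ⊕ blockSum t n (drop n x)) % 2
    ≡⟨ weight-⊕-%2 (take n x) _ ⟩
  (weight (take n x) + weight (blockSum t n (drop n x))) % 2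
    ≡⟨ +-cong-%2 (weight (take n x)) (weight-blockSum-%2 t n (drop n x)) ⟩
  (weight (take n x) + weight (drop n x)) % 2
    ≡⟨ cong (_% 2) (weight-++ (take n x) (drop n x)) ⟨
  weight (take n x ++ drop n x) % 2
    ≡⟨ cong (λ z → weight z % 2) (take++drop≡id n x) ⟩
  weight x % 2 ∎

isVertex-blockSum : ∀ t n {x : Vec Bool (t * n)} → IsVertex x → IsVertex (blockSum t n x)
isVertex-blockSum t n {x} x-even = trans (weight-blockSum-%2 t n x) x-even

-- Sums over all binary words

sumWords : ∀ m → (Vec Bool m → ℕ) → ℕ
sumWords zero f = f []
sumWords (suc m) f = sumWords m (f ∘ (false ∷_)) + sumWords m (f ∘ (true ∷_))

sumWords-cong : ∀ m {f g : Vec Bool m → ℕ} → (∀ x → f x ≡ g x) → sumWords m f ≡ sumWords m g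
sumWords-cong zero f≡g = f≡g []
sumWords-cong (suc m) f≡g =
  cong₂ _+_ (sumWords-cong m (f≡g ∘ (false ∷_))) (sumWords-cong m (f≡g ∘ (true ∷_)))

sumWords-+ : ∀ m (f g : Vec Bool m → ℕ) → sumWords m (λ x → f x + g x) ≡ sumWords m f + sumWords m g
sumWords-+ zero f g = refl
sumWords-+ (suc m) f g = begin
  sumWords m (λ u → f (false ∷ u) + g (false ∷ u)) + sumWords m (λ u → f (true ∷ u) + g (true ∷ u))
    ≡⟨ cong₂ _+_ (sumWords-+ m _ _) (sumWords-+ m _ _) ⟩
  (a + b) + (c + d)
    ≡⟨ solve 4 (λ a b c d → (a :+ b) :+ (c :+ d) := (a :+ c) :+ (b :+ d)) refl a b c d ⟩
  (a + c) + (b + d) ∎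
  where a = sumWords m (f ∘ (false ∷_))
        b = sumWords m (g ∘ (false ∷_))
        c = sumWords m (f ∘ (true ∷_))
        d = sumWords m (g ∘ (true ∷_))

sumWords-* : ∀ m c (f : Vec Bool m → ℕ) → sumWords m (λ x → c * f x) ≡ c * sumWords m f
sumWords-* zero c f = refl
sumWords-* (suc m) c f =
  trans (cong₂ _+_ (sumWords-* m c _) (sumWords-* m c _)) (sym (*-distribˡ-+ c _ _))

sumWords-zero : ∀ m → sumWords m (λ _ → 0) ≡ 0
sumWords-zero zero = refl
sumWords-zero (suc m) = cong₂ _+_ (sumWords-zero m) (sumWords-zero m)

sumWords-comm : ∀ a b (F : Vec Bool a → Vec Bool b → ℕ) →
                sumWords a (λ u → sumWords b (F u)) ≡ sumWords b (λ w → sumWords a (λ u → F u w))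
sumWords-comm zero b F = refl
sumWords-comm (suc a) b F =
  trans (cong₂ _+_ (sumWords-comm a b _) (sumWords-comm a b _)) (sym (sumWords-+ b _ _))

sumWords-++ : ∀ a b (F : Vec Bool (a + b) → ℕ) →
              sumWords (a + b) F ≡ sumWords a (λ u → sumWords b (λ w → F (u ++ w)))
sumWords-++ zero b F = refl
sumWords-++ (suc a) b F = cong₂ _+_ (sumWords-++ a b _) (sumWords-++ a b _)

sumWords-⊕ : ∀ m (v : Vec Bool m) F → sumWords m (λ e → F (v ⊕ e)) ≡ sumWords m F
sumWords-⊕ zero [] F = refl
sumWords-⊕ (suc m) (false ∷ v) F = cong₂ _+_ (sumWords-⊕ m v _) (sumWords-⊕ m v _)
sumWords-⊕ (suc m) (true ∷ v) F =
  trans (cong₂ _+_ (sumWords-⊕ m v _) (sumWords-⊕ m v _)) (+-comm (sumWords m _) _)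

sumWords-sum-allWords : ∀ m (f : Vec Bool m → ℕ) → sum (map f (allWords m)) ≡ sumWords m f
sumWords-sum-allWords zero f = +-identityʳ (f [])
sumWords-sum-allWords (suc m) f = begin
  sum (map f (map (false ∷_) ws List.++ map (true ∷_) ws))
    ≡⟨ cong sum (map-++ f (map (false ∷_) ws) _) ⟩
  sum (map f (map (false ∷_) ws) List.++ map f (map (true ∷_) ws))
    ≡⟨ sum-++ (map f (map (false ∷_) ws)) _ ⟩
  sum (map f (map (false ∷_) ws)) + sum (map f (map (true ∷_) ws))
    ≡⟨ cong₂ _+_ (cong sum (map-∘ ws)) (cong sum (map-∘ ws)) ⟨
  sum (map (f ∘ (false ∷_)) ws) + sum (map (f ∘ (true ∷_)) ws)
    ≡⟨ cong₂ _+_ (sumWords-sum-allWords m _) (sumWords-sum-allWords m _) ⟩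
  sumWords (suc m) f ∎
  where ws = allWords m

-- Sums over Hamming spheres centred at 0

sphereSum : ∀ {m} → ℕ → (Vec Bool m → ℕ) → ℕ
sphereSum {m} k g = sumWords m (λ d → 𝟙[wt≡ k ] d * g d)

sphereSum-cong : ∀ {m} k {f g : Vec Bool m → ℕ} → (∀ x → f x ≡ g x) → sphereSum k f ≡ sphereSum k g
sphereSum-cong {m} k f≡g = sumWords-cong m (λ x → cong (𝟙[wt≡ k ] x *_) (f≡g x))

sphereSum-* : ∀ {m} k c (f : Vec Bool m → ℕ) → sphereSum k (λ x → c * f x) ≡ c * sphereSum k f
sphereSum-* {m} k c f = trans
  (sumWords-cong m (λ x → solve 3 (λ i c y → i :* (c :* y) := c :* (i :* y)) refl (𝟙[wt≡ k ] x) c (f x)))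
  (sumWords-* m c _)

sphereSum-0 : ∀ {m} (g : Vec Bool m → ℕ) → sphereSum 0 g ≡ g (replicate m false)
sphereSum-0 {zero} g = +-identityʳ (g [])
sphereSum-0 {suc m} g =
  trans (cong₂ _+_ (sphereSum-0 (g ∘ (false ∷_))) (sumWords-zero m)) (+-identityʳ _)

length-filterᵇ² : ∀ {a} {A : Set a} (p q : A → Bool) (xs : List A) →
                  length (filterᵇ p (filterᵇ q xs)) ≡ sum (map (λ x → 𝟙 (q x ∧ p x)) xs)
length-filterᵇ² p q [] = refl
length-filterᵇ² p q (x ∷ xs) with q x
... | false = length-filterᵇ² p q xs
... | true with p x
...   | false = length-filterᵇ² p q xs
...   | true = cong suc (length-filterᵇ² p q xs)

-- Words at distance 2 from an even word are even, so the even-weight filter in nbrsIn is redundant.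
nbrsIn-sphereSum : ∀ {m k} (D : Vec Bool m → Fin k) (v : Vec Bool m) → IsVertex v → ∀ j →
                   nbrsIn D v j ≡ sphereSum 2 (λ e → 𝟙 ⌊ D (v ⊕ e) ≟ j ⌋)
nbrsIn-sphereSum {m} D v v-even j = begin
  nbrsIn D v j
    ≡⟨ length-filterᵇ² _ evenᵇ (allWords m) ⟩
  sum (map (λ w → 𝟙 (evenᵇ w ∧ (atDistance2 w ∧ inCell w))) (allWords m))
    ≡⟨ sumWords-sum-allWords m _ ⟩
  sumWords m (λ w → 𝟙 (evenᵇ w ∧ (atDistance2 w ∧ inCell w)))
    ≡⟨ sumWords-cong m drop-evenᵇ ⟩
  sumWords m (λ w → 𝟙 (atDistance2 w) * 𝟙 (inCell w))
    ≡⟨ sumWords-⊕ m v _ ⟨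
  sumWords m (λ e → 𝟙 (atDistance2 (v ⊕ e)) * 𝟙 (inCell (v ⊕ e)))
    ≡⟨ sumWords-cong m (λ e → cong (λ z → 𝟙 (weight z ≡ᵇ 2) * 𝟙 (inCell (v ⊕ e))) (⊕-cancelˡ v e)) ⟩
  sphereSum 2 (λ e → 𝟙 (inCell (v ⊕ e))) ∎
  where
  atDistance2 inCell : Vec Bool m → Bool
  atDistance2 w = dist v w ≡ᵇ 2
  inCell w = ⌊ D w ≟ j ⌋
  drop-evenᵇ : ∀ w → 𝟙 (evenᵇ w ∧ (atDistance2 w ∧ inCell w)) ≡ 𝟙 (atDistance2 w) * 𝟙 (inCell w)
  drop-evenᵇ w with atDistance2 w in d≡2
  ... | false = cong 𝟙 (∧-zeroʳ (evenᵇ w))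
  ... | true rewrite isVertex-dist≡2 v w v-even (≡ᵇ⇒≡ (dist v w) 2 (subst T (sym d≡2) _)) =
    sym (+-identityʳ _)

𝟙-+≡1-split : ∀ a b → 𝟙 (a + b ≡ᵇ 1) ≡ 𝟙 (a ≡ᵇ 0) * 𝟙 (b ≡ᵇ 1) + 𝟙 (a ≡ᵇ 1) * 𝟙 (b ≡ᵇ 0)
𝟙-+≡1-split zero          zero          = refl
𝟙-+≡1-split zero          (suc zero)    = refl
𝟙-+≡1-split zero          (suc (suc b)) = refl
𝟙-+≡1-split (suc zero)    zero          = refl
𝟙-+≡1-split (suc zero)    (suc zero)    = refl
𝟙-+≡1-split (suc zero)    (suc (suc b)) = refl
𝟙-+≡1-split (suc (suc a)) zero          = refl
𝟙-+≡1-split (suc (suc a)) (suc zero)    = refl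
𝟙-+≡1-split (suc (suc a)) (suc (suc b)) = refl

𝟙-+≡2-split : ∀ a b → 𝟙 (a + b ≡ᵇ 2) ≡
              (𝟙 (a ≡ᵇ 0) * 𝟙 (b ≡ᵇ 2) + 𝟙 (a ≡ᵇ 1) * 𝟙 (b ≡ᵇ 1)) + 𝟙 (a ≡ᵇ 2) * 𝟙 (b ≡ᵇ 0)
𝟙-+≡2-split zero                zero                = refl
𝟙-+≡2-split zero                (suc zero)          = refl
𝟙-+≡2-split zero                (suc (suc zero))    = refl
𝟙-+≡2-split zero                (suc (suc (suc b))) = refl
𝟙-+≡2-split (suc zero)          zero                = refl
𝟙-+≡2-split (suc zero)          (suc zero)          = refl
𝟙-+≡2-split (suc zero)          (suc (suc zero))    = refl
𝟙-+≡2-split (suc zero)          (suc (suc (suc b))) = refl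
𝟙-+≡2-split (suc (suc zero))    zero                = refl
𝟙-+≡2-split (suc (suc zero))    (suc zero)          = refl
𝟙-+≡2-split (suc (suc zero))    (suc (suc zero))    = refl
𝟙-+≡2-split (suc (suc zero))    (suc (suc (suc b))) = refl
𝟙-+≡2-split (suc (suc (suc a))) zero                = refl
𝟙-+≡2-split (suc (suc (suc a))) (suc zero)          = refl
𝟙-+≡2-split (suc (suc (suc a))) (suc (suc zero))    = refl
𝟙-+≡2-split (suc (suc (suc a))) (suc (suc (suc b))) = refl

sumWords²-+ : ∀ a b (F G : Vec Bool a → Vec Bool b → ℕ) →
              sumWords a (λ u → sumWords b (λ w → F u w + G u w)) ≡
              sumWords a (λ u → sumWords b (F u)) + sumWords a (λ u → sumWords b (G u))
sumWords²-+ a b F G = trans (sumWords-cong a (λ u → sumWords-+ b (F u) (G u))) (sumWords-+ a _ _)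

sumWords²-sphereSum : ∀ a b i j (F : Vec Bool a → Vec Bool b → ℕ) →
  sumWords a (λ u → sumWords b (λ w → 𝟙[wt≡ i ] u * 𝟙[wt≡ j ] w * F u w)) ≡
  sphereSum i (λ u → sphereSum j (F u))
sumWords²-sphereSum a b i j F = sumWords-cong a (λ u → trans
  (sumWords-cong b (λ w → *-assoc (𝟙[wt≡ i ] u) (𝟙[wt≡ j ] w) (F u w)))
  (sumWords-* b (𝟙[wt≡ i ] u) _))

module _ (a b : ℕ) (F : Vec Bool a → Vec Bool b → ℕ) where

  private
    F∘splitAt : Vec Bool (a + b) → ℕ
    F∘splitAt e = F (take a e) (drop a e)

    F∘splitAt-++ : ∀ u w → F∘splitAt (u ++ w) ≡ F u w
    F∘splitAt-++ u w = cong₂ F (take-++ a u w) (drop-++ a u w)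

    𝟙[wt≡]-++ : ∀ k (u : Vec Bool a) (w : Vec Bool b) →
                𝟙[wt≡ k ] (u ++ w) ≡ 𝟙 (weight u + weight w ≡ᵇ k)
    𝟙[wt≡]-++ k u w = cong (λ z → 𝟙 (z ≡ᵇ k)) (weight-++ u w)

  sphereSum₁-splitAt : sphereSum 1 F∘splitAt ≡
    sphereSum 0 (λ u → sphereSum 1 (F u)) + sphereSum 1 (λ u → sphereSum 0 (F u))
  sphereSum₁-splitAt = begin
    sphereSum 1 F∘splitAt
      ≡⟨ sumWords-++ a b _ ⟩
    sumWords a (λ u → sumWords b (λ w → 𝟙[wt≡ 1 ] (u ++ w) * F∘splitAt (u ++ w)))
      ≡⟨ sumWords-cong a (λ u → sumWords-cong b (λ w → split u w)) ⟩
    sumWords a (λ u → sumWords b (λ w → 𝟙[wt≡ 0 ] u * 𝟙[wt≡ 1 ] w * F u w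
                                         + 𝟙[wt≡ 1 ] u * 𝟙[wt≡ 0 ] w * F u w))
      ≡⟨ trans (sumWords²-+ a b _ _)
               (cong₂ _+_ (sumWords²-sphereSum a b 0 1 F) (sumWords²-sphereSum a b 1 0 F)) ⟩
    sphereSum 0 (λ u → sphereSum 1 (F u)) + sphereSum 1 (λ u → sphereSum 0 (F u)) ∎
    where
    split : ∀ u w → 𝟙[wt≡ 1 ] (u ++ w) * F∘splitAt (u ++ w) ≡
            𝟙[wt≡ 0 ] u * 𝟙[wt≡ 1 ] w * F u w + 𝟙[wt≡ 1 ] u * 𝟙[wt≡ 0 ] w * F u w
    split u w = trans
      (cong₂ _*_ (trans (𝟙[wt≡]-++ 1 u w) (𝟙-+≡1-split (weight u) (weight w))) (F∘splitAt-++ u w))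
      (solve 5 (λ x₀ y₁ x₁ y₀ f → (x₀ :* y₁ :+ x₁ :* y₀) :* f := x₀ :* y₁ :* f :+ x₁ :* y₀ :* f)
             refl (𝟙[wt≡ 0 ] u) (𝟙[wt≡ 1 ] w) (𝟙[wt≡ 1 ] u) (𝟙[wt≡ 0 ] w) (F u w))

  sphereSum₂-splitAt : sphereSum 2 F∘splitAt ≡
    (sphereSum 0 (λ u → sphereSum 2 (F u)) + sphereSum 1 (λ u → sphereSum 1 (F u)))
    + sphereSum 2 (λ u → sphereSum 0 (F u))
  sphereSum₂-splitAt = begin
    sphereSum 2 F∘splitAt
      ≡⟨ sumWords-++ a b _ ⟩
    sumWords a (λ u → sumWords b (λ w → 𝟙[wt≡ 2 ] (u ++ w) * F∘splitAt (u ++ w)))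
      ≡⟨ sumWords-cong a (λ u → sumWords-cong b (λ w → split u w)) ⟩
    sumWords a (λ u → sumWords b (λ w → (𝟙[wt≡ 0 ] u * 𝟙[wt≡ 2 ] w * F u w
                                          + 𝟙[wt≡ 1 ] u * 𝟙[wt≡ 1 ] w * F u w)
                                         + 𝟙[wt≡ 2 ] u * 𝟙[wt≡ 0 ] w * F u w))
      ≡⟨ trans (sumWords²-+ a b _ _) (cong₂ _+_
               (trans (sumWords²-+ a b _ _)
                      (cong₂ _+_ (sumWords²-sphereSum a b 0 2 F) (sumWords²-sphereSum a b 1 1 F)))
               (sumWords²-sphereSum a b 2 0 F)) ⟩
    (sphereSum 0 (λ u → sphereSum 2 (F u)) + sphereSum 1 (λ u → sphereSum 1 (F u)))
    + sphereSum 2 (λ u → sphereSum 0 (F u)) ∎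
    where
    split : ∀ u w → 𝟙[wt≡ 2 ] (u ++ w) * F∘splitAt (u ++ w) ≡
            (𝟙[wt≡ 0 ] u * 𝟙[wt≡ 2 ] w * F u w + 𝟙[wt≡ 1 ] u * 𝟙[wt≡ 1 ] w * F u w)
            + 𝟙[wt≡ 2 ] u * 𝟙[wt≡ 0 ] w * F u w
    split u w = trans
      (cong₂ _*_ (trans (𝟙[wt≡]-++ 2 u w) (𝟙-+≡2-split (weight u) (weight w))) (F∘splitAt-++ u w))
      (solve 7 (λ x₀ y₂ x₁ y₁ x₂ y₀ f → ((x₀ :* y₂ :+ x₁ :* y₁) :+ x₂ :* y₀) :* f
                  := (x₀ :* y₂ :* f :+ x₁ :* y₁ :* f) :+ x₂ :* y₀ :* f)
             refl (𝟙[wt≡ 0 ] u) (𝟙[wt≡ 2 ] w) (𝟙[wt≡ 1 ] u) (𝟙[wt≡ 1 ] w) (𝟙[wt≡ 2 ] u) (𝟙[wt≡ 0 ] w) (F u w))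

sphereSum-zero : ∀ {m} k → sphereSum {m} k (λ _ → 0) ≡ 0
sphereSum-zero {m} k = trans (sumWords-cong m (λ x → *-zeroʳ (𝟙[wt≡ k ] x))) (sumWords-zero m)

sphereSum₁-wt₀-⊕ : ∀ {n} (x : Vec Bool n) → sphereSum 1 (λ u → 𝟙[wt≡ 0 ] (u ⊕ x)) ≡ 𝟙[wt≡ 1 ] x
sphereSum₁-wt₀-⊕ [] = refl
sphereSum₁-wt₀-⊕ {suc n} (false ∷ x) =
  trans (cong₂ _+_ (sphereSum₁-wt₀-⊕ x) (sphereSum-zero {n} 0)) (+-identityʳ _)
sphereSum₁-wt₀-⊕ {suc n} (true ∷ x) = begin
  sphereSum {n} 1 (λ _ → 0) + sphereSum 0 (λ u → 𝟙[wt≡ 0 ] (u ⊕ x))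
    ≡⟨ cong₂ _+_ (sphereSum-zero {n} 1) (sphereSum-0 (λ u → 𝟙[wt≡ 0 ] (u ⊕ x))) ⟩
  𝟙[wt≡ 0 ] (replicate n false ⊕ x)
    ≡⟨ cong 𝟙[wt≡ 0 ] (⊕-identityˡ x) ⟩
  𝟙[wt≡ 0 ] x ∎

sphereSum₁-wt₁-⊕ : ∀ {n} (x : Vec Bool n) →
                   sphereSum 1 (λ u → 𝟙[wt≡ 1 ] (u ⊕ x)) ≡ 2 * 𝟙[wt≡ 2 ] x + n * 𝟙[wt≡ 0 ] x
sphereSum₁-wt₁-⊕ [] = refl
sphereSum₁-wt₁-⊕ {suc n} (false ∷ x) = begin
  sphereSum 1 (λ u → 𝟙[wt≡ 1 ] (u ⊕ x)) + sphereSum 0 (λ u → 𝟙[wt≡ 0 ] (u ⊕ x))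
    ≡⟨ cong₂ _+_ (sphereSum₁-wt₁-⊕ x)
                 (trans (sphereSum-0 (λ u → 𝟙[wt≡ 0 ] (u ⊕ x))) (cong 𝟙[wt≡ 0 ] (⊕-identityˡ x))) ⟩
  (2 * 𝟙[wt≡ 2 ] x + n * 𝟙[wt≡ 0 ] x) + 𝟙[wt≡ 0 ] x
    ≡⟨ solve 3 (λ a b c → (con 2 :* a :+ b :* c) :+ c := con 2 :* a :+ (con 1 :+ b) :* c)
             refl (𝟙[wt≡ 2 ] x) n (𝟙[wt≡ 0 ] x) ⟩
  2 * 𝟙[wt≡ 2 ] x + suc n * 𝟙[wt≡ 0 ] x ∎
sphereSum₁-wt₁-⊕ {suc n} (true ∷ x) = begin
  sphereSum 1 (λ u → 𝟙[wt≡ 0 ] (u ⊕ x)) + sphereSum 0 (λ u → 𝟙[wt≡ 1 ] (u ⊕ x))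
    ≡⟨ cong₂ _+_ (sphereSum₁-wt₀-⊕ x)
                 (trans (sphereSum-0 (λ u → 𝟙[wt≡ 1 ] (u ⊕ x))) (cong 𝟙[wt≡ 1 ] (⊕-identityˡ x))) ⟩
  𝟙[wt≡ 1 ] x + 𝟙[wt≡ 1 ] x
    ≡⟨ solve 2 (λ a b → a :+ a := con 2 :* a :+ (con 1 :+ b) :* con 0) refl (𝟙[wt≡ 1 ] x) n ⟩
  2 * 𝟙[wt≡ 1 ] x + suc n * 0 ∎

sphereSum₁-sphereSum₁-⊕ : ∀ n (g : Vec Bool n → ℕ) →
  sphereSum 1 (λ u → sphereSum 1 (λ d → g (u ⊕ d))) ≡ 2 * sphereSum 2 g + n * g (replicate n false)
sphereSum₁-sphereSum₁-⊕ n g = begin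
  sphereSum 1 (λ u → sphereSum 1 (λ d → g (u ⊕ d)))
    ≡⟨ sphereSum-cong 1 recentre ⟩
  sumWords n (λ u → 𝟙[wt≡ 1 ] u * sumWords n (λ x → 𝟙[wt≡ 1 ] (u ⊕ x) * g x))
    ≡⟨ sumWords-cong n (λ u → sym (sumWords-* n (𝟙[wt≡ 1 ] u) _)) ⟩
  sumWords n (λ u → sumWords n (λ x → 𝟙[wt≡ 1 ] u * (𝟙[wt≡ 1 ] (u ⊕ x) * g x)))
    ≡⟨ sumWords-comm n n _ ⟩
  sumWords n (λ x → sumWords n (λ u → 𝟙[wt≡ 1 ] u * (𝟙[wt≡ 1 ] (u ⊕ x) * g x)))
    ≡⟨ sumWords-cong n (λ x → trans (sumWords-cong n (λ u → reorder (𝟙[wt≡ 1 ] u) _ (g x)))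
                                    (sumWords-* n (g x) _)) ⟩
  sumWords n (λ x → g x * sphereSum 1 (λ u → 𝟙[wt≡ 1 ] (u ⊕ x)))
    ≡⟨ sumWords-cong n (λ x → trans (cong (g x *_) (sphereSum₁-wt₁-⊕ x)) (distribute x)) ⟩
  sumWords n (λ x → 2 * (𝟙[wt≡ 2 ] x * g x) + n * (𝟙[wt≡ 0 ] x * g x))
    ≡⟨ trans (sumWords-+ n _ _) (cong₂ _+_ (sumWords-* n 2 _) (sumWords-* n n _)) ⟩
  2 * sphereSum 2 g + n * sphereSum 0 g
    ≡⟨ cong (λ z → 2 * sphereSum 2 g + n * z) (sphereSum-0 g) ⟩
  2 * sphereSum 2 g + n * g (replicate n false) ∎
  where
  recentre : ∀ u → sphereSum 1 (λ d → g (u ⊕ d)) ≡ sumWords n (λ x → 𝟙[wt≡ 1 ] (u ⊕ x) * g x)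
  recentre u = trans (sym (sumWords-⊕ n u _))
                     (sumWords-cong n (λ x → cong (λ z → 𝟙[wt≡ 1 ] (u ⊕ x) * g z) (⊕-cancelˡ u x)))
  reorder : ∀ a b c → a * (b * c) ≡ c * (a * b)
  reorder = solve 3 (λ a b c → a :* (b :* c) := c :* (a :* b)) refl
  distribute : ∀ x → g x * (2 * 𝟙[wt≡ 2 ] x + n * 𝟙[wt≡ 0 ] x) ≡
                     2 * (𝟙[wt≡ 2 ] x * g x) + n * (𝟙[wt≡ 0 ] x * g x)
  distribute x = solve 4 (λ G a b N → G :* (con 2 :* a :+ N :* b) := con 2 :* (a :* G) :+ N :* (b :* G))
                       refl (g x) (𝟙[wt≡ 2 ] x) (𝟙[wt≡ 0 ] x) n

-- Sphere sums pulled back along the block sum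

sphereSum-firstBlock₀ : ∀ t n k (g : Vec Bool n → ℕ) →
  sphereSum 0 (λ u → sphereSum k (λ w → g (u ⊕ blockSum t n w))) ≡ sphereSum k (g ∘ blockSum t n)
sphereSum-firstBlock₀ t n k g =
  trans (sphereSum-0 (λ u → sphereSum k (λ w → g (u ⊕ blockSum t n w))))
        (sphereSum-cong {t * n} k (λ w → cong g (⊕-identityˡ _)))

sphereSum-otherBlocks₀ : ∀ t n k (g : Vec Bool n → ℕ) →
  sphereSum k (λ u → sphereSum 0 (λ w → g (u ⊕ blockSum t n w))) ≡ sphereSum k g
sphereSum-otherBlocks₀ t n k g = sphereSum-cong k (λ u →
  trans (sphereSum-0 (λ w → g (u ⊕ blockSum t n w)))
        (cong g (trans (cong (u ⊕_) (blockSum-zeros t n)) (⊕-identityʳ u))))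

sphereSum₁-blockSum : ∀ t n (g : Vec Bool n → ℕ) → sphereSum 1 (g ∘ blockSum t n) ≡ t * sphereSum 1 g
sphereSum₁-blockSum zero n g = refl
sphereSum₁-blockSum (suc t) n g = begin
  sphereSum 1 (g ∘ blockSum (suc t) n)
    ≡⟨ sphereSum₁-splitAt n (t * n) G ⟩
  sphereSum 0 (λ u → sphereSum 1 (G u)) + sphereSum 1 (λ u → sphereSum 0 (G u))
    ≡⟨ cong₂ _+_ (sphereSum-firstBlock₀ t n 1 g) (sphereSum-otherBlocks₀ t n 1 g) ⟩
  sphereSum 1 (g ∘ blockSum t n) + sphereSum 1 g
    ≡⟨ cong (_+ sphereSum 1 g) (sphereSum₁-blockSum t n g) ⟩
  t * sphereSum 1 g + sphereSum 1 g
    ≡⟨ +-comm (t * sphereSum 1 g) _ ⟩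
  suc t * sphereSum 1 g ∎
  where
  G : Vec Bool n → Vec Bool (t * n) → ℕ
  G u w = g (u ⊕ blockSum t n w)

choose2 : ℕ → ℕ
choose2 zero = 0
choose2 (suc t) = choose2 t + t

sphereSum₂-blockSum : ∀ t n (g : Vec Bool n → ℕ) →
  sphereSum 2 (g ∘ blockSum t n) ≡ t * t * sphereSum 2 g + n * choose2 t * g (replicate n false)
sphereSum₂-blockSum zero n g = cong (_* g (replicate n false)) (sym (*-zeroʳ n))
sphereSum₂-blockSum (suc t) n g = begin
  sphereSum 2 (g ∘ blockSum (suc t) n)
    ≡⟨ sphereSum₂-splitAt n (t * n) G ⟩
  (sphereSum 0 (λ u → sphereSum 2 (G u)) + sphereSum 1 (λ u → sphereSum 1 (G u)))
  + sphereSum 2 (λ u → sphereSum 0 (G u))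
    ≡⟨ cong₂ _+_ (cong₂ _+_ (sphereSum-firstBlock₀ t n 2 g) bothBlocks₁) (sphereSum-otherBlocks₀ t n 2 g) ⟩
  (sphereSum 2 (g ∘ blockSum t n) + t * (2 * S₂ + n * g₀)) + S₂
    ≡⟨ cong (λ z → (z + t * (2 * S₂ + n * g₀)) + S₂) (sphereSum₂-blockSum t n g) ⟩
  ((t * t * S₂ + n * choose2 t * g₀) + t * (2 * S₂ + n * g₀)) + S₂
    ≡⟨ solve 5 (λ T X N R Z → ((T :* T :* X :+ N :* R :* Z) :+ T :* (con 2 :* X :+ N :* Z)) :+ X
                 := (con 1 :+ T) :* (con 1 :+ T) :* X :+ N :* (R :+ T) :* Z) refl t S₂ n (choose2 t) g₀ ⟩
  suc t * suc t * S₂ + n * choose2 (suc t) * g₀ ∎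
  where
  G : Vec Bool n → Vec Bool (t * n) → ℕ
  G u w = g (u ⊕ blockSum t n w)
  S₂ = sphereSum 2 g
  g₀ = g (replicate n false)
  bothBlocks₁ : sphereSum 1 (λ u → sphereSum 1 (λ w → g (u ⊕ blockSum t n w))) ≡ t * (2 * S₂ + n * g₀)
  bothBlocks₁ = begin
    sphereSum 1 (λ u → sphereSum 1 (λ w → g (u ⊕ blockSum t n w)))
      ≡⟨ sphereSum-cong 1 (λ u → sphereSum₁-blockSum t n (λ d → g (u ⊕ d))) ⟩
    sphereSum 1 (λ u → t * sphereSum 1 (λ d → g (u ⊕ d)))
      ≡⟨ sphereSum-* 1 t (λ u → sphereSum 1 (λ d → g (u ⊕ d))) ⟩
    t * sphereSum 1 (λ u → sphereSum 1 (λ d → g (u ⊕ d)))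
      ≡⟨ cong (t *_) (sphereSum₁-sphereSum₁-⊕ n g) ⟩
    t * (2 * S₂ + n * g₀) ∎

choose2*2≡t*[t∸1] : ∀ t → choose2 t * 2 ≡ t * (t ∸ 1)
choose2*2≡t*[t∸1] zero = refl
choose2*2≡t*[t∸1] (suc zero) = refl
choose2*2≡t*[t∸1] (suc (suc s)) = begin
  (choose2 (suc s) + suc s) * 2  ≡⟨ *-distribʳ-+ 2 (choose2 (suc s)) (suc s) ⟩
  choose2 (suc s) * 2 + suc s * 2 ≡⟨ cong (_+ suc s * 2) (choose2*2≡t*[t∸1] (suc s)) ⟩
  suc s * s + suc s * 2           ≡⟨ solve 1 (λ s → (con 1 :+ s) :* s :+ (con 1 :+ s) :* con 2
                                                  := (con 2 :+ s) :* (con 1 :+ s)) refl s ⟩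
  suc (suc s) * suc s             ∎

choose2≡t*[t∸1]/2 : ∀ t → choose2 t ≡ t * (t ∸ 1) / 2
choose2≡t*[t∸1]/2 t = sym (trans (cong (_/ 2) (sym (choose2*2≡t*[t∸1] t))) (m*n/n≡m (choose2 t) 2))

nbrsIn-lift : ∀ t n {k} (C : Vec Bool n → Fin k) (x : Vec Bool (t * n)) → IsVertex x → ∀ j →
  nbrsIn (lift t n C) x j ≡
  t * t * nbrsIn C (blockSum t n x) j + n * choose2 t * Id (C (blockSum t n x)) j
nbrsIn-lift t n C x x-even j = begin
  nbrsIn (lift t n C) x j
    ≡⟨ nbrsIn-sphereSum (lift t n C) x x-even j ⟩
  sphereSum 2 (λ e → 𝟙 ⌊ C (blockSum t n (x ⊕ e)) ≟ j ⌋)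
    ≡⟨ sphereSum-cong 2 (λ e → cong (λ z → 𝟙 ⌊ C z ≟ j ⌋) (blockSum-⊕ t n x e)) ⟩
  sphereSum 2 (g ∘ blockSum t n)
    ≡⟨ sphereSum₂-blockSum t n g ⟩
  t * t * sphereSum 2 g + n * choose2 t * g (replicate n false)
    ≡⟨ cong₂ (λ a b → t * t * a + n * choose2 t * b)
             (sym (nbrsIn-sphereSum C s (isVertex-blockSum t n x-even) j))
             (cong (λ z → 𝟙 ⌊ C z ≟ j ⌋) (⊕-identityʳ s)) ⟩
  t * t * nbrsIn C s j + n * choose2 t * Id (C s) j ∎
  where
  s = blockSum t n x
  g : Vec Bool n → ℕ
  g d = 𝟙 ⌊ C (s ⊕ d) ≟ j ⌋

lift-cellsNonempty : ∀ t n {k} (C : Vec Bool n → Fin k) →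
                     CellsNonempty C → CellsNonempty (lift (suc t) n C)
lift-cellsNonempty t n C nonempty i with nonempty i
... | v , v-even , v∈Cᵢ = v ++ zeros , padded-even , padded∈Cᵢ
  where
  zeros = replicate (t * n) false
  padded-even : IsVertex (v ++ zeros)
  padded-even = begin
    weight (v ++ zeros) % 2       ≡⟨ cong (_% 2) (weight-++ v zeros) ⟩
    (weight v + weight zeros) % 2 ≡⟨ cong (λ z → (weight v + z) % 2) (weight-replicate-false (t * n)) ⟩
    (weight v + 0) % 2            ≡⟨ cong (_% 2) (+-identityʳ (weight v)) ⟩
    weight v % 2                  ≡⟨ v-even ⟩
    0                             ∎
  padded∈Cᵢ : lift (suc t) n C (v ++ zeros) ≡ i
  padded∈Cᵢ = begin
    C (blockSum (suc t) n (v ++ zeros)) ≡⟨ cong C (blockSum-++ t n v zeros) ⟩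
    C (v ⊕ blockSum t n zeros)          ≡⟨ cong (λ z → C (v ⊕ z)) (blockSum-zeros t n) ⟩
    C (v ⊕ replicate n false)           ≡⟨ cong C (⊕-identityʳ v) ⟩
    C v                                 ≡⟨ v∈Cᵢ ⟩
    i                                   ∎

lemma4 : (n k t : ℕ) → (C : Vec Bool n → Fin k) → (S : Fin k → Fin k → ℕ) →
    IsEquitable n k C S → t ≥ 1 →
    IsEquitable (t * n) k (lift t n C) (liftedQuotient t n S)
lemma4 n k t@(suc t-1) C S (nonempty , equitable) _ =
  lift-cellsNonempty t-1 n C nonempty , lift-equitable
  where
  lift-equitable : ∀ x → IsVertex x → ∀ j →
                   nbrsIn (lift t n C) x j ≡ liftedQuotient t n S (lift t n C x) j
  lift-equitable x x-even j = begin
    nbrsIn (lift t n C) x j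
      ≡⟨ nbrsIn-lift t n C x x-even j ⟩
    t * t * nbrsIn C s j + n * choose2 t * Id (C s) j
      ≡⟨ cong₂ (λ a b → t * t * a + n * b * Id (C s) j)
               (equitable s (isVertex-blockSum t n x-even) j) (choose2≡t*[t∸1]/2 t) ⟩
    liftedQuotient t n S (C s) j ∎
    where s = blockSum t n x
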